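{- Let $\mathcal P$ be a normal logic program and let $\mathcal H$ be an N$^4$ Herbrand model of $\mathcal P$. Then $\mathcal H$ is stable if and only if $\mathcal H$ is complete and is a minimal N$^4$ Herbrand model of $\mathcal P$.
   Context: Fix a first-order language $\mathcal L$ with a non-empty set of constants, function symbols, predicate symbols of arities $n\ge 0$, the falsum $\bot$ (not an atom), connectives $\neg,\wedge,\vee$ and quantifiers $\forall,\exists$; $\neg^n$ is $n$-fold negation, $\top:=\neg\bot$. An N$^4$ interpretation $\mathcal I=(D,\mathit{val})$ consists of a non-empty set $D$ and an assignment with $\mathit{val}(c)\in D$ for constants, $\mathit{val}(f):D^n\to D$ for $n$-ary function symbols, for $0$-ary predicate symbols $p$ truth values $\mathit{val}(p),\mathit{val}(\neg^2 p)$ with $\mathit{val}(p)=\mathbf{true}\Rightarrow\mathit{val}(\neg^2p)=\mathbf{true}$, and for $n$-ary $p$ ($n\ge1$) relations $\mathit{val}(p)\subseteq\mathit{val}(\neg^2p)\subseteq D^n$. Variable assignments and term values are as in classical logic. Write $p(\bar t)$ for a $0$-ary $p$ or $p(t_1,\dots,t_n)$; it "holds in" $R$ if $R=\mathbf{true}$ (0-ary case) or the tuple of values of the $t_i$ lies in $R$. The valuation: (1.1) $p(\bar t)$ true iff it holds in $\mathit{val}(p)$; (1.2)–(1.5) $\wedge,\vee,\forall,\exists$ are evaluated classically; (2.1) $\neg\bot$ is true and $\neg p(\bar t)$ is true iff $p(\bar t)$ is not true; (2.2)–(2.5) $\neg(F_1\wedge F_2)$, $\neg(F_1\vee F_2)$,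 $\neg\forall xF$, $\neg\exists xF$ have the values of $(\neg F_1\vee\neg F_2)$, $(\neg F_1\wedge\neg F_2)$, $\exists x\neg F$, $\forall x\neg F$; (3.1) $\neg^2p(\bar t)$ true iff it holds in $\mathit{val}(\neg^2p)$; (3.2)–(3.5) $\neg^2(F_1\wedge F_2)$, $\neg^2(F_1\vee F_2)$, $\neg^2\forall xF$, $\neg^2\exists xF$ have the values of $(\neg^2F_1\wedge\neg^2F_2)$, $(\neg^2F_1\vee\neg^2F_2)$, $\forall x\neg^2F$, $\exists x\neg^2F$; (4) $\neg^3F$ is true iff $\neg^2F$ is not true; (5) a formula is false iff not made true by these clauses. An N$^4$ interpretation is complete if for every formula $F$ and every variable assignment $\mathcal V$, $\mathit{val}_{\mathcal I,\mathcal V}(F)=\mathit{val}_{\mathcal I,\mathcal V}(\neg^2F)$. An N$^4$ Herbrand interpretation has domain the set of ground terms, with constants and function symbols interpreted by themselves. $B^2_{\mathcal L}$ is the set of ground atoms $A$ and doubly negated ground atoms $\neg^2A$; $M\subseteq B^2_{\mathcal L}$ is closed if $A\in M\Rightarrow\neg^2A\in M$; for closed $M$, $\mathcal H^2(M)$ is the unique N$^4$ Herbrand interpretation in which $L\in B^2_{\mathcal L}$ is true iff $L\in M$. A general program clause is $A\leftarrow B_1,\dots,B_n$ ($n\ge0$) with $A$ an atom and each $B_i$ an atom or negated atom; a normal logic program is a finite set of such clauses. An N$^4$ interpretation satisfies a clause if it is an N$^4$ model (true under some variable assignment) of the associated N$^4$ clause $\forall x_1\dots\forall x_k(\dots(A\vee\neg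 B_1)\vee\dots\vee\neg B_n)$, $x_1,\dots,x_k$ being its variables and, for $B_i=\neg C$, $\neg B_i$ being $\neg^2C$ (double negations not eliminated); it is an N$^4$ model of $\mathcal P$ if it satisfies all clauses of $\mathcal P$. $\mathcal H^2(M)$ is a minimal N$^4$ Herbrand model of $\mathcal P$ if it is an N$^4$ model of $\mathcal P$ and $\mathcal H^2(B)$ is not, for every closed $B\subseteq M$ with $B\neq M$. Stable models (Gelfond–Lifschitz): for a set $N$ of ground atoms, let $\mathrm{Simp}_N(\mathrm{Ground}(\mathcal P))$ be obtained from the set of ground instances of clauses of $\mathcal P$ by deleting every clause whose body contains a literal $\neg B$ with $B\in N$ and then deleting all negative literals from the remaining bodies; the classical Herbrand interpretation with true atoms $N$ is a stable model of $\mathcal P$ if $N$ is exactly the set of ground atoms classically entailed by $\mathrm{Simp}_N(\mathrm{Ground}(\mathcal P))$. An N$^4$ Herbrand interpretation is called stable if it equals $\mathcal H^2(N\cup\{\neg^2A\mid A\in N\})$ for some set $N$ of ground atoms whose classical Herbrand interpretation is a stable model of $\mathcal P$. -}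

module Defs where

open import Level using (0ℓ) renaming (suc to lsuc)
open import Data.Nat using (ℕ; suc; _≟_)
open import Data.Vec using (Vec; []; _∷_)
open import Data.List using (List; []; _∷_; _++_; foldl; foldr; map)
open import Data.List.Membership.Propositional using (_∈_)
open import Data.List.Relation.Unary.All using (All)
open import Data.Product using (Σ; _×_; _,_; Σ-syntax)
open import Data.Sum using (_⊎_)
open import Data.Unit using (⊤)
open import Data.Empty using (⊥)
open import Relation.Nullary using (¬_; yes; no)
open import Relation.Unary using (Pred; _⊆_; _≐_)
open import Relation.Binary.PropositionalEquality using (_≡_)
open import Function.Bundles using (_⇔_)

-- A first-order language: constants (non-empty), function symbols of
-- arity n+1 (Fun n = symbols of arity suc n), predicate symbols of arity n ≥ 0.
record Language : Set₁ where
  field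
    Const : Set
    c₀    : Const
    Fun   : ℕ → Set
    PredS : ℕ → Set

module WithLang (L : Language) where
  open Language L

  Var : Set
  Var = ℕ

  data Term : Set where
    var   : Var → Term
    const : Const → Term
    app   : {n : ℕ} → Fun n → Vec Term (suc n) → Term

  data GTerm : Set where
    gconst : Const → GTerm
    gapp   : {n : ℕ} → Fun n → Vec GTerm (suc n) → GTerm

  data Formula : Set where
    ⊥f   : Formula
    atom : {n : ℕ} → PredS n → Vec Term n → Formula
    ¬f_  : Formula → Formula
    _∧f_ : Formula → Formula → Formula
    _∨f_ : Formula → Formula → Formula
    ∀f   : Var → Formula → Formula
    ∃f   : Var → Formula → Formula

  record N4Interp : Set₁ where
    field
      D     : Set
      d₀    : D
      valc  : Const → D
      valf  : {n : ℕ} → Fun n → Vec D (suc n) → D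
      val1  : {n : ℕ} → PredS n → Vec D n → Set
      val2  : {n : ℕ} → PredS n → Vec D n → Set   -- val(¬²p)
      incl  : {n : ℕ} (p : PredS n) (ds : Vec D n) → val1 p ds → val2 p ds

  module Sem (I : N4Interp) where
    open N4Interp I

    Assignment : Set
    Assignment = Var → D

    _[_↦_] : Assignment → Var → D → Assignment
    (V [ x ↦ d ]) y with x ≟ y
    ... | yes _ = d
    ... | no  _ = V y

    mutual
      evalT : Assignment → Term → D
      evalT V (var x)    = V x
      evalT V (const c)  = valc c
      evalT V (app f ts) = valf f (evalTs V ts)

      evalTs : {n : ℕ} → Assignment → Vec Term n → Vec D n
      evalTs V []       = []
      evalTs V (t ∷ ts) = evalT V t ∷ evalTs V ts

    mutual
      True : Assignment → Formula → Set
      True V ⊥f          = ⊥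
      True V (atom p ts) = val1 p (evalTs V ts)
      True V (¬f F)      = TrueNeg V F
      True V (F ∧f G)    = True V F × True V G
      True V (F ∨f G)    = True V F ⊎ True V G
      True V (∀f x F)    = (d : D) → True (V [ x ↦ d ]) F
      True V (∃f x F)    = Σ[ d ∈ D ] True (V [ x ↦ d ]) F

      TrueNeg : Assignment → Formula → Set
      TrueNeg V ⊥f          = ⊤
      TrueNeg V (atom p ts) = ¬ val1 p (evalTs V ts)
      TrueNeg V (¬f F)      = TrueNeg2 V F
      TrueNeg V (F ∧f G)    = TrueNeg V F ⊎ TrueNeg V G
      TrueNeg V (F ∨f G)    = TrueNeg V F × TrueNeg V G
      TrueNeg V (∀f x F)    = Σ[ d ∈ D ] TrueNeg (V [ x ↦ d ]) F
      TrueNeg V (∃f x F)    = (d : D) → TrueNeg (V [ x ↦ d ]) F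

      TrueNeg2 : Assignment → Formula → Set
      TrueNeg2 V ⊥f          = ⊥      -- not covered by any clause, hence false
      TrueNeg2 V (atom p ts) = val2 p (evalTs V ts)
      TrueNeg2 V (¬f F)      = ¬ TrueNeg2 V F
      TrueNeg2 V (F ∧f G)    = TrueNeg2 V F × TrueNeg2 V G
      TrueNeg2 V (F ∨f G)    = TrueNeg2 V F ⊎ TrueNeg2 V G
      TrueNeg2 V (∀f x F)    = (d : D) → TrueNeg2 (V [ x ↦ d ]) F
      TrueNeg2 V (∃f x F)    = Σ[ d ∈ D ] TrueNeg2 (V [ x ↦ d ]) F

  Complete : N4Interp → Set
  Complete I = (F : Formula) (V : Sem.Assignment I) →
               Sem.True I V F ⇔ Sem.True I V (¬f (¬f F))

  Atom : Set
  Atom = Σ[ n ∈ ℕ ] (PredS n × Vec Term n)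

  data Literal : Set where
    pos : Atom → Literal
    neg : Atom → Literal

  record Clause : Set where
    constructor _←_
    field
      head : Atom
      body : List Literal

  Program : Set
  Program = List Clause

  mutual
    varsT : Term → List Var
    varsT (var x)    = x ∷ []
    varsT (const c)  = []
    varsT (app f ts) = varsTs ts

    varsTs : {n : ℕ} → Vec Term n → List Var
    varsTs []       = []
    varsTs (t ∷ ts) = varsT t ++ varsTs ts

  varsA : Atom → List Var
  varsA (_ , _ , ts) = varsTs ts

  varsL : Literal → List Var
  varsL (pos a) = varsA a
  varsL (neg a) = varsA a

  varsC : Clause → List Var
  varsC (h ← bs) = varsA h ++ foldr (λ l vs → varsL l ++ vs) [] bs

  atomF : Atom → Formula
  atomF (_ , p , ts) = atom p ts

  negLit : Literal → Formula
  negLit (pos C) = ¬f (atomF C)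
  negLit (neg C) = ¬f (¬f (atomF C))

  clauseFormula : Clause → Formula
  clauseFormula c@(h ← bs) =
    foldr ∀f (foldl (λ F l → F ∨f negLit l) (atomF h) bs) (varsC c)

  Satisfies : N4Interp → Clause → Set
  Satisfies I c = Σ[ V ∈ Sem.Assignment I ] Sem.True I V (clauseFormula c)

  IsN4Model : N4Interp → Program → Set
  IsN4Model I P = (c : Clause) → c ∈ P → Satisfies I c

  GAtom : Set
  GAtom = Σ[ n ∈ ℕ ] (PredS n × Vec GTerm n)

  -- N⁴ Herbrand interpretation: determined by val(p), val(¬²p) on ground terms
  record HInterp : Set₁ where
    field
      hval1 : {n : ℕ} → PredS n → Vec GTerm n → Set
      hval2 : {n : ℕ} → PredS n → Vec GTerm n → Set
      hincl : {n : ℕ} (p : PredS n) (ts : Vec GTerm n) → hval1 p ts → hval2 p ts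

  toN4 : HInterp → N4Interp
  toN4 H = record
    { D = GTerm ; d₀ = gconst c₀ ; valc = gconst ; valf = gapp
    ; val1 = HInterp.hval1 H ; val2 = HInterp.hval2 H ; incl = HInterp.hincl H }

  data B2 : Set where
    b-atom : GAtom → B2
    b-dneg : GAtom → B2

  Closed : Pred B2 0ℓ → Set
  Closed M = (A : GAtom) → M (b-atom A) → M (b-dneg A)

  H² : (M : Pred B2 0ℓ) → Closed M → HInterp
  H² M cl = record
    { hval1 = λ p ts → M (b-atom (_ , p , ts))
    ; hval2 = λ p ts → M (b-dneg (_ , p , ts))
    ; hincl = λ p ts → cl (_ , p , ts) }

  truthSet : HInterp → Pred B2 0ℓ
  truthSet H (b-atom (_ , p , ts)) = HInterp.hval1 H p ts
  truthSet H (b-dneg (_ , p , ts)) = HInterp.hval2 H p ts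

  IsHModel : HInterp → Program → Set
  IsHModel H P = IsN4Model (toN4 H) P

  -- H = H²(M) with M = truthSet H; minimality as in the paper
  MinimalHModel : Program → HInterp → Set₁
  MinimalHModel P H =
    IsHModel H P ×
    ((B : Pred B2 0ℓ) (cl : Closed B) → B ⊆ truthSet H → ¬ (B ≐ truthSet H) →
       ¬ IsHModel (H² B cl) P)

  data GLiteral : Set where
    gpos : GAtom → GLiteral
    gneg : GAtom → GLiteral

  Subst : Set
  Subst = Var → GTerm

  mutual
    substT : Subst → Term → GTerm
    substT σ (var x)    = σ x
    substT σ (const c)  = gconst c
    substT σ (app f ts) = gapp f (substTs σ ts)

    substTs : {n : ℕ} → Subst → Vec Term n → Vec GTerm n
    substTs σ []       = []
    substTs σ (t ∷ ts) = substT σ t ∷ substTs σ ts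

  substA : Subst → Atom → GAtom
  substA σ (n , p , ts) = (n , p , substTs σ ts)

  substL : Subst → Literal → GLiteral
  substL σ (pos a) = gpos (substA σ a)
  substL σ (neg a) = gneg (substA σ a)

  DefClause : Set
  DefClause = GAtom × List GAtom

  positives : List GLiteral → List GAtom
  positives []            = []
  positives (gpos a ∷ ls) = a ∷ positives ls
  positives (gneg _ ∷ ls) = positives ls

  NotBlocked : Pred GAtom 0ℓ → GLiteral → Set
  NotBlocked N (gpos _) = ⊤
  NotBlocked N (gneg B) = ¬ N B

  Simp : Pred GAtom 0ℓ → Program → Pred DefClause 0ℓ
  Simp N P (h , bs) =
    Σ[ c ∈ Clause ] Σ[ _ ∈ c ∈ P ] Σ[ σ ∈ Subst ]
      let gbody = map (substL σ) (Clause.body c) in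
      All (NotBlocked N) gbody ×
      h ≡ substA σ (Clause.head c) ×
      bs ≡ positives gbody

  record ClInterp : Set₁ where
    field
      CD    : Set
      cvalc : Const → CD
      cvalf : {n : ℕ} → Fun n → Vec CD (suc n) → CD
      crel  : {n : ℕ} → PredS n → Vec CD n → Set

  module ClSem (J : ClInterp) where
    open ClInterp J
    mutual
      cevalG : GTerm → CD
      cevalG (gconst c)  = cvalc c
      cevalG (gapp f ts) = cvalf f (cevalGs ts)

      cevalGs : {n : ℕ} → Vec GTerm n → Vec CD n
      cevalGs []       = []
      cevalGs (t ∷ ts) = cevalG t ∷ cevalGs ts

    TrueGA : GAtom → Set
    TrueGA (_ , p , ts) = crel p (cevalGs ts)

    TrueDC : DefClause → Set
    TrueDC (h , bs) = All TrueGA bs → TrueGA h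

  Entails : Pred DefClause 0ℓ → GAtom → Set₁
  Entails S A = (J : ClInterp) →
    ((dc : DefClause) → S dc → ClSem.TrueDC J dc) → ClSem.TrueGA J A

  -- the classical Herbrand interpretation with true atoms N is a stable model
  IsStableModel : Program → Pred GAtom 0ℓ → Set₁
  IsStableModel P N = N ≐ Entails (Simp N P)

  dclose : Pred GAtom 0ℓ → Pred B2 0ℓ
  dclose N (b-atom A) = N A
  dclose N (b-dneg A) = N A

  dclose-closed : (N : Pred GAtom 0ℓ) → Closed (dclose N)
  dclose-closed N A x = x

  _≈H_ : HInterp → HInterp → Set
  H ≈H H' = truthSet H ≐ truthSet H'

  Stable : Program → HInterp → Set₁
  Stable P H = Σ[ N ∈ Pred GAtom 0ℓ ]
    IsStableModel P N × (H ≈H H² (dclose N) (dclose-closed N))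

-- Over the Herbrand universe an assignment is a ground substitution, so a clause holds in H iff
-- each of its ground instances has a true head or a body literal L with ¬L true: a positive atom
-- that is not true, or a negated atom ¬B with ¬²B true.  Hence if every true ¬²A has A ∈ N, then
-- every atom derivable from Simp_N(Ground P) is true in H.
-- If H comes from a stable model N, it gives A and ¬²A the same value, which makes it complete;
-- a closed submodel B of H has its ¬²-part inside N, so B contains the atoms derivable from
-- Simp_N(Ground P), which are exactly N, and therefore B = H.
-- Conversely, completeness makes ¬²A true only when A is.  With N the true atoms of H, the atoms
-- derivable from Simp_N(Ground P) lie in N, and together with {¬²A | A ∈ N} they form a closed
-- model below H.  By minimality this model is H, i.e. N is stable.

{-# OPTIONS --safe #-}
module Submission where

open import Defs
open import Level using (Level; 0ℓ; lift; lower) renaming (suc to lsuc)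
open import Function.Base using (_∘_; id)
open import Data.Product using (_×_; _,_; proj₁; proj₂)
open import Data.Sum using (_⊎_; inj₁; inj₂)
open import Data.Empty using (⊥-elim)
open import Data.Nat using (ℕ; _≟_)
open import Data.Vec using (Vec; []; _∷_)
open import Data.List using (List; []; _∷_; _++_; foldl; foldr; map)
open import Data.List.Membership.Propositional using (_∈_)
open import Data.List.Membership.Propositional.Properties using (∈-++⁺ˡ; ∈-++⁺ʳ)
open import Data.List.Relation.Unary.All as All using (All; []; _∷_)
open import Data.List.Relation.Unary.Any using (Any; here; there)
open import Data.List.Relation.Unary.Any.Properties using (Any-cong; map↔)
open import Data.Sum.Function.Propositional using (_⊎-cong_)
open import Relation.Nullary using (¬_; yes; no)
open import Relation.Nullary.Decidable using (map′)
open import Relation.Unary using (Pred; _⊆_; _≐_)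
open import Relation.Binary.PropositionalEquality using (_≡_; refl; sym; cong; cong₂; subst)
open import Function.Bundles using (_⇔_; mk⇔; Equivalence)
open import Function.Related.Propositional as Related using (≡⇒; K-refl)
open import Axiom.ExcludedMiddle using (ExcludedMiddle)
open import Axiom.DoubleNegationElimination using (em⇒dne)

lowerEM : ExcludedMiddle (lsuc 0ℓ) → ExcludedMiddle 0ℓ
lowerEM em = map′ lower lift em

module NormalPrograms (L : Language) where
  open Language L
  open WithLang L

  private variable
    ℓ : Level
    n : ℕ
    S : Pred DefClause 0ℓ
    W σ : Subst

  ClosedUnder : Pred DefClause 0ℓ → Pred GAtom ℓ → Set ℓ
  ClosedUnder S Q = ∀ {h bs} → S (h , bs) → All Q bs → Q h

  data Derivable (S : Pred DefClause 0ℓ) : Pred GAtom 0ℓ where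
    derive : ∀ {h bs} → S (h , bs) → All (Derivable S) bs → Derivable S h

  module _ {Q : Pred GAtom ℓ} (closed : ClosedUnder S Q) where
    mutual
      derivable-least : Derivable S ⊆ Q
      derivable-least (derive s ds) = closed s (all-derivable-least ds)

      all-derivable-least : ∀ {bs} → All (Derivable S) bs → All Q bs
      all-derivable-least []       = []
      all-derivable-least (d ∷ ds) = derivable-least d ∷ all-derivable-least ds

  termModel : Pred GAtom 0ℓ → ClInterp
  termModel Q = record
    { CD = GTerm ; cvalc = gconst ; cvalf = gapp ; crel = λ p ts → Q (_ , p , ts) }

  module _ (Q : Pred GAtom 0ℓ) where
    open ClSem (termModel Q)

    mutual
      cevalG-id : (t : GTerm) → cevalG t ≡ t
      cevalG-id (gconst c)  = refl
      cevalG-id (gapp f ts) = cong (gapp f) (cevalGs-id ts)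

      cevalGs-id : (ts : Vec GTerm n) → cevalGs ts ≡ ts
      cevalGs-id []       = refl
      cevalGs-id (t ∷ ts) = cong₂ _∷_ (cevalG-id t) (cevalGs-id ts)

    termModel-true⇔ : (A : GAtom) → TrueGA A ⇔ Q A
    termModel-true⇔ (_ , p , ts) = mk⇔ (subst Qp (cevalGs-id ts)) (subst Qp (sym (cevalGs-id ts)))
      where Qp = λ ts → Q (_ , p , ts)

  entails≐derivable : (S : Pred DefClause 0ℓ) → Entails S ≐ Derivable S
  entails≐derivable S = (λ {A} ent → Equivalence.to (termModel-true⇔ D A) (ent (termModel D) D⊨S))
                      , (λ d J J⊨S → derivable-least (J⊨S _) d)
    where
      D = Derivable S

      D⊨S : (dc : DefClause) → S dc → ClSem.TrueDC (termModel D) dc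
      D⊨S (h , bs) s trueBody = Equivalence.from (termModel-true⇔ D h)
        (derive s (All.map (Equivalence.to (termModel-true⇔ D _)) trueBody))

  _∨¬_ : Formula → Literal → Formula
  F ∨¬ l = F ∨f negLit l

  matrix : Clause → Formula
  matrix c = foldl _∨¬_ (atomF (Clause.head c)) (Clause.body c)

  module _ (I : N4Interp) where
    open Sem I

    _[_⇐_] : Assignment → List Var → Assignment → Assignment
    V [ []     ⇐ σ ] = V
    V [ x ∷ xs ⇐ σ ] = (V [ x ↦ σ x ]) [ xs ⇐ σ ]

    private variable
      V U : Assignment
      F G : Formula

    update-on : ∀ x → (V [ x ↦ U x ]) x ≡ U x
    update-on x with x ≟ x
    ... | yes _  = refl
    ... | no x≢x = ⊥-elim (x≢x refl)

    update-agrees : ∀ x {y} → V y ≡ U y → (V [ x ↦ U x ]) y ≡ U y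
    update-agrees x {y} V≡U with x ≟ y
    ... | yes refl = refl
    ... | no _     = V≡U

    override-agrees : ∀ xs {y} → V y ≡ U y → (V [ xs ⇐ U ]) y ≡ U y
    override-agrees          []       V≡U = V≡U
    override-agrees {V} {U} (x ∷ xs) V≡U = override-agrees xs (update-agrees {V} {U} x V≡U)

    override-on : ∀ {xs y} → y ∈ xs → (V [ xs ⇐ U ]) y ≡ U y
    override-on {V} {U} {x ∷ xs} (here refl)  = override-agrees xs (update-on {V} {U} x)
    override-on {xs = x ∷ xs}    (there y∈xs) = override-on y∈xs

    ∀-closure-elim : ∀ xs → True V (foldr ∀f G xs) → True (V [ xs ⇐ U ]) G
    ∀-closure-elim []       t = t
    ∀-closure-elim {U = U} (x ∷ xs) t = ∀-closure-elim xs (t (U x))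

    ∀-closure-intro : ∀ xs → (∀ U → True U G) → True V (foldr ∀f G xs)
    ∀-closure-intro []       t = t _
    ∀-closure-intro (x ∷ xs) t _ = ∀-closure-intro xs t

    foldl-∨¬⇔ : ∀ bs → True V (foldl _∨¬_ F bs) ⇔ (True V F ⊎ Any (True V ∘ negLit) bs)
    foldl-∨¬⇔ bs = mk⇔ (to bs) (from bs)
      where
        to : ∀ {F} bs → True V (foldl _∨¬_ F bs) → True V F ⊎ Any (True V ∘ negLit) bs
        to []       t = inj₁ t
        to (l ∷ ls) t with to ls t
        ... | inj₁ (inj₁ tF) = inj₁ tF
        ... | inj₁ (inj₂ tl) = inj₂ (here tl)
        ... | inj₂ tls       = inj₂ (there tls)

        from : ∀ {F} bs → True V F ⊎ Any (True V ∘ negLit) bs → True V (foldl _∨¬_ F bs)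
        from []       (inj₁ tF)         = tF
        from (l ∷ ls) (inj₁ tF)         = from ls (inj₁ (inj₁ tF))
        from (l ∷ ls) (inj₂ (here tl))  = from ls (inj₁ (inj₂ tl))
        from (l ∷ ls) (inj₂ (there tls)) = from ls (inj₂ tls)

  module _ (em : ExcludedMiddle 0ℓ) (I : N4Interp) where
    open N4Interp I
    open Sem I

    private
      dne = em⇒dne em

    module _ (val2⊆val1 : ∀ {n} (p : PredS n) ds → val2 p ds → val1 p ds) where
      mutual
        true⇒true¬¬ : ∀ F V → True V F → TrueNeg2 V F
        true⇒true¬¬ (atom p ts) V t         = incl p _ t
        true⇒true¬¬ (¬f F)      V t t¬¬     = true¬⇒¬true F V t (true¬¬⇒true F V t¬¬)
        true⇒true¬¬ (F ∧f G)    V (t , u)   = true⇒true¬¬ F V t , true⇒true¬¬ G V u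
        true⇒true¬¬ (F ∨f G)    V (inj₁ t)  = inj₁ (true⇒true¬¬ F V t)
        true⇒true¬¬ (F ∨f G)    V (inj₂ u)  = inj₂ (true⇒true¬¬ G V u)
        true⇒true¬¬ (∀f x F)    V t d       = true⇒true¬¬ F _ (t d)
        true⇒true¬¬ (∃f x F)    V (d , t)   = d , true⇒true¬¬ F _ t

        true¬¬⇒true : ∀ F V → TrueNeg2 V F → True V F
        true¬¬⇒true (atom p ts) V t         = val2⊆val1 p _ t
        true¬¬⇒true (¬f F)      V ¬t¬¬      = ¬true⇒true¬ F V (¬t¬¬ ∘ true⇒true¬¬ F V)
        true¬¬⇒true (F ∧f G)    V (t , u)   = true¬¬⇒true F V t , true¬¬⇒true G V u
        true¬¬⇒true (F ∨f G)    V (inj₁ t)  = inj₁ (true¬¬⇒true F V t)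
        true¬¬⇒true (F ∨f G)    V (inj₂ u)  = inj₂ (true¬¬⇒true G V u)
        true¬¬⇒true (∀f x F)    V t d       = true¬¬⇒true F _ (t d)
        true¬¬⇒true (∃f x F)    V (d , t)   = d , true¬¬⇒true F _ t

        true¬⇒¬true : ∀ F V → TrueNeg V F → ¬ True V F
        true¬⇒¬true (atom p ts) V ¬t          = ¬t
        true¬⇒¬true (¬f F)      V t¬¬ t¬      = true¬⇒¬true F V t¬ (true¬¬⇒true F V t¬¬)
        true¬⇒¬true (F ∧f G)    V (inj₁ t¬) (t , _) = true¬⇒¬true F V t¬ t
        true¬⇒¬true (F ∧f G)    V (inj₂ u¬) (_ , u) = true¬⇒¬true G V u¬ u
        true¬⇒¬true (F ∨f G)    V (t¬ , _) (inj₁ t) = true¬⇒¬true F V t¬ t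
        true¬⇒¬true (F ∨f G)    V (_ , u¬) (inj₂ u) = true¬⇒¬true G V u¬ u
        true¬⇒¬true (∀f x F)    V (d , t¬) t  = true¬⇒¬true F _ t¬ (t d)
        true¬⇒¬true (∃f x F)    V t¬ (d , t)  = true¬⇒¬true F _ (t¬ d) t

        ¬true⇒true¬ : ∀ F V → ¬ True V F → TrueNeg V F
        ¬true⇒true¬ ⊥f          V _  = _
        ¬true⇒true¬ (atom p ts) V ¬t = ¬t
        ¬true⇒true¬ (¬f F)      V ¬t¬ = true⇒true¬¬ F V (dne (¬t¬ ∘ ¬true⇒true¬ F V))
        ¬true⇒true¬ (F ∧f G)    V ¬t with em {True V F}
        ... | yes t = inj₂ (¬true⇒true¬ G V (¬t ∘ (t ,_)))
        ... | no ¬t₁ = inj₁ (¬true⇒true¬ F V ¬t₁)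
        ¬true⇒true¬ (F ∨f G)    V ¬t = ¬true⇒true¬ F V (¬t ∘ inj₁) , ¬true⇒true¬ G V (¬t ∘ inj₂)
        ¬true⇒true¬ (∀f x F)    V ¬t = dne (λ ¬∃ → ¬t (λ d → dne (¬∃ ∘ (d ,_) ∘ ¬true⇒true¬ F _)))
        ¬true⇒true¬ (∃f x F)    V ¬t d = ¬true⇒true¬ F _ (¬t ∘ (d ,_))

      val2⊆val1⇒complete : Complete I
      val2⊆val1⇒complete F V = mk⇔ (true⇒true¬¬ F V) (true¬¬⇒true F V)

  GroundClause : Set
  GroundClause = GAtom × List GLiteral

  ground : Subst → Clause → GroundClause
  ground σ c = substA σ (Clause.head c) , map (substL σ) (Clause.body c)

  varsBody : List Literal → List Var
  varsBody = foldr (λ l vs → varsL l ++ vs) []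

  _≗_on_ : Subst → Subst → List Var → Set
  W ≗ σ on xs = ∀ {y} → y ∈ xs → W y ≡ σ y

  mutual
    substT-cong : ∀ t → W ≗ σ on varsT t → substT W t ≡ substT σ t
    substT-cong (var x)    W≗σ = W≗σ (here refl)
    substT-cong (const c)  W≗σ = refl
    substT-cong (app f ts) W≗σ = cong (gapp f) (substTs-cong ts W≗σ)

    substTs-cong : (ts : Vec Term n) → W ≗ σ on varsTs ts → substTs W ts ≡ substTs σ ts
    substTs-cong []       W≗σ = refl
    substTs-cong (t ∷ ts) W≗σ =
      cong₂ _∷_ (substT-cong t (W≗σ ∘ ∈-++⁺ˡ)) (substTs-cong ts (W≗σ ∘ ∈-++⁺ʳ (varsT t)))

  substL-cong : ∀ l → W ≗ σ on varsL l → substL W l ≡ substL σ l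
  substL-cong (pos (_ , p , ts)) W≗σ = cong (λ ts → gpos (_ , p , ts)) (substTs-cong ts W≗σ)
  substL-cong (neg (_ , p , ts)) W≗σ = cong (λ ts → gneg (_ , p , ts)) (substTs-cong ts W≗σ)

  substBody-cong : ∀ bs → W ≗ σ on varsBody bs → map (substL W) bs ≡ map (substL σ) bs
  substBody-cong []       W≗σ = refl
  substBody-cong (l ∷ ls) W≗σ =
    cong₂ _∷_ (substL-cong l (W≗σ ∘ ∈-++⁺ˡ)) (substBody-cong ls (W≗σ ∘ ∈-++⁺ʳ (varsL l)))

  ground-cong : ∀ c → W ≗ σ on varsC c → ground W c ≡ ground σ c
  ground-cong (h@(_ , p , ts) ← bs) W≗σ = cong₂ _,_
    (cong (λ ts → (_ , p , ts)) (substTs-cong ts (W≗σ ∘ ∈-++⁺ˡ)))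
    (substBody-cong bs (W≗σ ∘ ∈-++⁺ʳ (varsA h)))

  module Herbrand (H : HInterp) where
    open HInterp H
    open Sem (toN4 H)

    True₁ True₂ : Pred GAtom 0ℓ
    True₁ A = truthSet H (b-atom A)
    True₂ A = truthSet H (b-dneg A)

    Refutes : GLiteral → Set
    Refutes (gpos A) = ¬ True₁ A
    Refutes (gneg A) = True₂ A

    SatisfiesGround : GroundClause → Set
    SatisfiesGround (h , ls) = True₁ h ⊎ Any Refutes ls

    true₁⊆true₂ : True₁ ⊆ True₂
    true₁⊆true₂ {_ , p , ts} = hincl p ts

    mutual
      evalT≡substT : (W : Subst) (t : Term) → evalT W t ≡ substT W t
      evalT≡substT W (var x)    = refl
      evalT≡substT W (const c)  = refl
      evalT≡substT W (app f ts) = cong (gapp f) (evalTs≡substTs W ts)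

      evalTs≡substTs : (W : Subst) (ts : Vec Term n) → evalTs W ts ≡ substTs W ts
      evalTs≡substTs W []       = refl
      evalTs≡substTs W (t ∷ ts) = cong₂ _∷_ (evalT≡substT W t) (evalTs≡substTs W ts)

    atom-true≡ : (W : Subst) (a : Atom) → True W (atomF a) ≡ True₁ (substA W a)
    atom-true≡ W (_ , p , ts) = cong (hval1 p) (evalTs≡substTs W ts)

    negLit-true≡ : (W : Subst) (l : Literal) → True W (negLit l) ≡ Refutes (substL W l)
    negLit-true≡ W (pos (_ , p , ts)) = cong (¬_ ∘ hval1 p) (evalTs≡substTs W ts)
    negLit-true≡ W (neg (_ , p , ts)) = cong (hval2 p) (evalTs≡substTs W ts)

    matrix⇔ground : (W : Subst) (c : Clause) → True W (matrix c) ⇔ SatisfiesGround (ground W c)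
    matrix⇔ground W c@(h ← bs) = begin
      True W (matrix c)
        ∼⟨ foldl-∨¬⇔ (toN4 H) bs ⟩
      (True W (atomF h) ⊎ Any (True W ∘ negLit) bs)
        ∼⟨ ≡⇒ (atom-true≡ W h) ⊎-cong Any-cong (≡⇒ ∘ negLit-true≡ W) K-refl ⟩
      (True₁ (substA W h) ⊎ Any (Refutes ∘ substL W) bs)
        ↔⟨ K-refl ⊎-cong map↔ ⟩
      SatisfiesGround (ground W c) ∎
      where open Related.EquationalReasoning {k = Related.equivalence}

    satisfies⇔ground : (c : Clause) → Satisfies (toN4 H) c ⇔ (∀ σ → SatisfiesGround (ground σ c))
    satisfies⇔ground c = mk⇔ to from
      where
        to : Satisfies (toN4 H) c → ∀ σ → SatisfiesGround (ground σ c)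
        to (V , t) σ = subst SatisfiesGround (ground-cong c (override-on (toN4 H)))
          (Equivalence.to (matrix⇔ground _ c) (∀-closure-elim (toN4 H) (varsC c) t))

        from : (∀ σ → SatisfiesGround (ground σ c)) → Satisfies (toN4 H) c
        from sat = (λ _ → gconst c₀) , ∀-closure-intro (toN4 H) (varsC c)
                                          (λ W → Equivalence.from (matrix⇔ground W c) (sat W))

    mutual
      embT : GTerm → Term
      embT (gconst c)  = const c
      embT (gapp f ts) = app f (embTs ts)

      embTs : Vec GTerm n → Vec Term n
      embTs []       = []
      embTs (t ∷ ts) = embT t ∷ embTs ts

    mutual
      evalT-embT : (V : Assignment) (t : GTerm) → evalT V (embT t) ≡ t
      evalT-embT V (gconst c)  = refl
      evalT-embT V (gapp f ts) = cong (gapp f) (evalTs-embTs V ts)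

      evalTs-embTs : (V : Assignment) (ts : Vec GTerm n) → evalTs V (embTs ts) ≡ ts
      evalTs-embTs V []       = refl
      evalTs-embTs V (t ∷ ts) = cong₂ _∷_ (evalT-embT V t) (evalTs-embTs V ts)

    complete⇔true₂⊆true₁ : ExcludedMiddle 0ℓ → Complete (toN4 H) ⇔ (True₂ ⊆ True₁)
    complete⇔true₂⊆true₁ em = mk⇔ to (λ t₂⊆t₁ → val2⊆val1⇒complete em (toN4 H) (λ p ts → t₂⊆t₁))
      where
        to : Complete (toN4 H) → True₂ ⊆ True₁
        to complete {_ , p , ts} t₂ =
          subst (hval1 p) (evalTs-embTs V ts) (Equivalence.from (complete (atom p (embTs ts)) V)
            (subst (hval2 p) (sym (evalTs-embTs V ts)) t₂))
          where V = λ _ → gconst c₀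

    holds⇒¬refuted : {N : Pred GAtom 0ℓ} → True₂ ⊆ N → ∀ {ls} →
      All True₁ (positives ls) → All (NotBlocked N) ls → ¬ Any Refutes ls
    holds⇒¬refuted t₂⊆N {gpos A ∷ ls} (t ∷ _)  _          (here ¬t)  = ¬t t
    holds⇒¬refuted t₂⊆N {gpos A ∷ ls} (_ ∷ ts) (_ ∷ nbs)  (there r)  = holds⇒¬refuted t₂⊆N ts nbs r
    holds⇒¬refuted t₂⊆N {gneg A ∷ ls} _        (A∉N ∷ _)  (here t₂)  = A∉N (t₂⊆N t₂)
    holds⇒¬refuted t₂⊆N {gneg A ∷ ls} ts       (_ ∷ nbs)  (there r)  = holds⇒¬refuted t₂⊆N ts nbs r

    ¬refuted⇒holds : ExcludedMiddle 0ℓ → ∀ ls → ¬ Any Refutes ls →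
      All True₁ (positives ls) × All (NotBlocked True₂) ls
    ¬refuted⇒holds em []            _  = [] , []
    ¬refuted⇒holds em (gpos A ∷ ls) ¬r =
      let ts , nbs = ¬refuted⇒holds em ls (¬r ∘ there) in em⇒dne em (¬r ∘ here) ∷ ts , _ ∷ nbs
    ¬refuted⇒holds em (gneg A ∷ ls) ¬r =
      let ts , nbs = ¬refuted⇒holds em ls (¬r ∘ there) in ts , ¬r ∘ here ∷ nbs

    derivable⊆true₁ : {P : Program} {N : Pred GAtom 0ℓ} →
      IsHModel H P → True₂ ⊆ N → Derivable (Simp N P) ⊆ True₁
    derivable⊆true₁ {P} {N} model t₂⊆N = derivable-least closed
      where
        closed : ClosedUnder (Simp N P) True₁
        closed (c , c∈P , σ , unblocked , refl , refl) body
          with Equivalence.to (satisfies⇔ground c) (model c c∈P) σ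
        ... | inj₁ head    = head
        ... | inj₂ refuted = ⊥-elim (holds⇒¬refuted t₂⊆N body unblocked refuted)

    stable-model⊆true₁ : ∀ {P N} → IsStableModel P N → IsHModel H P → True₂ ⊆ N → N ⊆ True₁
    stable-model⊆true₁ stable model t₂⊆N =
      derivable⊆true₁ model t₂⊆N ∘ proj₁ (entails≐derivable _) ∘ proj₁ stable

  GL : Program → Pred GAtom 0ℓ → Pred B2 0ℓ
  GL P N (b-atom A) = Derivable (Simp N P) A
  GL P N (b-dneg A) = N A

  GL-model : ExcludedMiddle 0ℓ → ∀ P N (cl : Closed (GL P N)) → IsHModel (H² (GL P N) cl) P
  GL-model em P N cl c c∈P = Equivalence.from (satisfies⇔ground c) ground-instances
    where
      open Herbrand (H² (GL P N) cl)
      ground-instances : ∀ σ → SatisfiesGround (ground σ c)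
      ground-instances σ with em {Any Refutes (proj₂ (ground σ c))}
      ... | yes refuted = inj₂ refuted
      ... | no ¬refuted =
        let body , unblocked = ¬refuted⇒holds em _ ¬refuted
        in inj₁ (derive (c , c∈P , σ , unblocked , refl , refl) body)

  module _ {P : Program} {H : HInterp} where
    open HInterp H
    open Herbrand H

    stable⇒complete : ExcludedMiddle 0ℓ → Stable P H → Complete (toN4 H)
    stable⇒complete em (N , _ , H≈) =
      Equivalence.from (complete⇔true₂⊆true₁ em) (proj₂ H≈ {b-atom _} ∘ proj₁ H≈ {b-dneg _})

    stable⇒minimal : IsHModel H P → Stable P H → MinimalHModel P H
    stable⇒minimal model (N , stable , H≈) = model , minimal
      where
        t₂⊆N : True₂ ⊆ N
        t₂⊆N = proj₁ H≈ {b-dneg _}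

        minimal : ∀ B cl → B ⊆ truthSet H → ¬ (B ≐ truthSet H) → ¬ IsHModel (H² B cl) P
        minimal B cl B⊆H B≠H modelB = B≠H (B⊆H , H⊆B)
          where
            N⊆B : N ⊆ B ∘ b-atom
            N⊆B = Herbrand.stable-model⊆true₁ (H² B cl) stable modelB (t₂⊆N ∘ B⊆H)

            H⊆B : truthSet H ⊆ B
            H⊆B {b-atom A} = N⊆B ∘ proj₁ H≈ {b-atom A}
            H⊆B {b-dneg A} = cl A ∘ N⊆B ∘ t₂⊆N

    complete∧minimal⇒stable : ExcludedMiddle 0ℓ → IsHModel H P →
      Complete (toN4 H) × MinimalHModel P H → Stable P H
    complete∧minimal⇒stable em model (complete , _ , minimal) = True₁ , stable , H≈
      where
        t₂⊆t₁ : True₂ ⊆ True₁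
        t₂⊆t₁ = Equivalence.to (complete⇔true₂⊆true₁ em) complete

        derivable⊆t₁ : Derivable (Simp True₁ P) ⊆ True₁
        derivable⊆t₁ = derivable⊆true₁ model t₂⊆t₁

        GL⊆H : GL P True₁ ⊆ truthSet H
        GL⊆H {b-atom A} = derivable⊆t₁
        GL⊆H {b-dneg A} = true₁⊆true₂

        GL≐H : GL P True₁ ≐ truthSet H
        GL≐H = em⇒dne em λ GL≠H →
          minimal (GL P True₁) (λ _ → derivable⊆t₁) (λ {x} → GL⊆H {x}) GL≠H (GL-model em P True₁ _)

        stable : IsStableModel P True₁
        stable = proj₂ (entails≐derivable _) ∘ proj₂ GL≐H {b-atom _}
               , derivable⊆t₁ ∘ proj₁ (entails≐derivable _)

        H≈ : H ≈H H² (dclose True₁) (dclose-closed True₁)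
        H≈ = (λ { {b-atom A} → id ; {b-dneg A} → t₂⊆t₁ })
           , (λ { {b-atom A} → id ; {b-dneg A} → true₁⊆true₂ })

proposition9 : ExcludedMiddle (lsuc 0ℓ) → (L : Language) →
    let open WithLang L in
    (P : Program) (H : HInterp) → IsHModel H P →
    Stable P H ⇔ (Complete (toN4 H) × MinimalHModel P H)
proposition9 em L P H model =
  mk⇔ (λ stable → stable⇒complete em₀ stable , stable⇒minimal model stable)
      (complete∧minimal⇒stable em₀ model)
  where
    open NormalPrograms L
    em₀ = lowerEM em
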